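{- Let $\mathcal{R}$ be a finite valuation ring of order $q^r$, and let $\mathcal{E}$ be a set of $8q^{2r-1}$ points in $\mathcal{R}^2$. Then there exists a point $\mathbf{z}\in\mathcal{E}$ such that $\mathbf{z}$ is contained in at least $q^r/8$ lines, each of which passes through at least $q^{r-1}+1$ points of $\mathcal{E}$.
   Context: $\mathcal{R}$ is a finite valuation ring: a finite commutative local ring with identity whose ideals are totally ordered by inclusion (a finite chain ring); its residue field has $q$ elements, $q$ an odd prime power, and $|\mathcal{R}|=q^r$; $\mathcal{R}^0$ denotes its set of non-units. A line in $\mathcal{R}^2$ is a set $\{(x,y)\in\mathcal{R}^2\colon ax+by+c=0\}$ with $(a,b,c)\in\mathcal{R}^3\setminus(\mathcal{R}^0)^3$. -}

module Defs where

open import Level using (0ℓ) renaming (suc to lsuc)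
open import Data.Nat using (ℕ; _^_; _≤_)
open import Data.Nat.Divisibility using (_∣_)
open import Data.Nat.Primality using (Prime)
open import Data.Nat.Properties using ()
open import Data.Fin using (Fin)
open import Data.Bool using (Bool; true; false)
open import Data.Product using (Σ; ∃; _×_; _,_)
open import Data.Sum using (_⊎_)
open import Data.Empty using (⊥)
open import Relation.Nullary using (¬_)
open import Relation.Binary.PropositionalEquality using (_≡_; _≢_)
open import Algebra.Core using (Op₁; Op₂)
open import Algebra.Structures using (IsCommutativeRing)
open import Function.Bundles using (_↔_)
open import Function.Definitions using (Injective)

record CRing : Set₁ where
  field
    Carrier : Set
    _+_ _*_ : Op₂ Carrier
    -_      : Op₁ Carrier
    0# 1#   : Carrier
    isCommutativeRing : IsCommutativeRing _≡_ _+_ _*_ -_ 0# 1#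

  infixl 6 _+_
  infixl 7 _*_

  _-_ : Op₂ Carrier
  x - y = x + (- y)

  IsUnit : Carrier → Set
  IsUnit x = ∃ λ y → x * y ≡ 1#

  IsNonUnit : Carrier → Set
  IsNonUnit x = ¬ IsUnit x

  record IsIdeal (I : Carrier → Bool) : Set where
    field
      zero-∈ : I 0# ≡ true
      +-∈    : ∀ x y → I x ≡ true → I y ≡ true → I (x + y) ≡ true
      *-∈    : ∀ a x → I x ≡ true → I (a * x) ≡ true

  _⊆_ : (Carrier → Bool) → (Carrier → Bool) → Set
  I ⊆ J = ∀ x → I x ≡ true → J x ≡ true

  -- local ring: 1 ≠ 0 and the non-units form an ideal (closed under +)
  IsLocal : Set
  IsLocal = (1# ≢ 0#) × (∀ x y → IsNonUnit x → IsNonUnit y → IsNonUnit (x + y))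

  IsChain : Set
  IsChain = ∀ I J → IsIdeal I → IsIdeal J → (I ⊆ J) ⊎ (J ⊆ I)

  -- the residue field 𝓡/𝓡⁰ has exactly q elements: a bijection between Fin q
  -- and the cosets of the maximal ideal 𝓡⁰ (complete, irredundant representatives)
  ResidueFieldCard : ℕ → Set
  ResidueFieldCard q =
    Σ (Fin q → Carrier) λ rep →
      (∀ i j → IsNonUnit (rep i - rep j) → i ≡ j) ×
      (∀ x → ∃ λ i → IsNonUnit (x - rep i))

  Point : Set
  Point = Carrier × Carrier

  Triple : Set
  Triple = Carrier × Carrier × Carrier

  ValidTriple : Triple → Set
  ValidTriple (a , b , c) = ¬ (IsNonUnit a × IsNonUnit b × IsNonUnit c)

  OnLine : Triple → Point → Set
  OnLine (a , b , c) (x , y) = a * x + b * y + c ≡ 0#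

  SameLine : Triple → Triple → Set
  SameLine ℓ ℓ' = ∀ p → (OnLine ℓ p → OnLine ℓ' p) × (OnLine ℓ' p → OnLine ℓ p)

OddPrimePower : ℕ → Set
OddPrimePower q = ∃ λ p → ∃ λ k → Prime p × ¬ (2 ∣ p) × 1 ≤ k × q ≡ p ^ k

record FiniteValuationRing (q r : ℕ) : Set₁ where
  field
    ring      : CRing
  open CRing ring public
  field
    local     : IsLocal
    chain     : IsChain
    residue   : ResidueFieldCard q
    q-odd-pp  : OddPrimePower q
    order     : Carrier ↔ Fin (q ^ r)

module Submission where

-- For each slope a the lines y = -(a x + c), c ∈ ℛ, partition the plane. With |E| = 8 q^(2r-1),
-- the q^r lines of one slope carrying at most q^(r-1) points of E account for at most
-- q^(2r-1) = |E|/8 incidences, so at least 7|E|/8 incidences per slope lie on rich lines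
-- (more than q^(r-1) points). Summing over the q^r slopes and averaging over E, some point of E
-- lies on at least 7q^r/8 rich lines; these have distinct slopes, hence are distinct lines.

open import Defs
open import Level using (0ℓ)
open import Data.Fin using (Fin; inject≤) renaming (zero to fzero; suc to fsuc)
open import Data.Fin.Properties using (_≟_; any?; suc-injective; inject≤-injective; nonZeroIndex)
open import Data.Bool.Base using (if_then_else_)
open import Data.Product using (Σ; ∃; _×_; _,_; proj₁; proj₂)
open import Function.Base using (_∘_)
open import Function.Bundles using (Inverse; Injection)
open import Function.Definitions using (Injective)
open import Function.Properties.Inverse using (↔⇒↣; ↔-sym)
open import Relation.Nullary using (does; Dec; yes; no; contradiction)
open import Relation.Unary using (Pred; Decidable)
open import Relation.Binary.PropositionalEquality
  using (_≡_; refl; sym; trans; cong; cong₂; subst; module ≡-Reasoning)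
open import Algebra.Bundles using (CommutativeRing)
import Algebra.Properties.Group as GroupProperties

module Lines (ℛ : CRing) where
  open CRing ℛ

  commutativeRing : CommutativeRing 0ℓ 0ℓ
  commutativeRing = record { isCommutativeRing = isCommutativeRing }

  open CommutativeRing commutativeRing
    using (+-assoc; +-comm; +-identityˡ; zeroʳ; *-identityˡ; *-identityʳ; -‿inverseˡ; -‿inverseʳ; +-group)
  open GroupProperties +-group using (inverseʳ-unique; ⁻¹-involutive; ∙-cancelʳ)

  intercept : Carrier → Point → Carrier
  intercept a (x , y) = - (a * x + y)

  onLine-intercept : ∀ a p → OnLine (a , 1# , intercept a p) p
  onLine-intercept a (x , y) =
    trans (cong (λ t → a * x + t + intercept a (x , y)) (*-identityˡ y)) (-‿inverseʳ (a * x + y))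

  ax+1y+c≡y+[ax+c] : ∀ a c x y → a * x + 1# * y + c ≡ y + (a * x + c)
  ax+1y+c≡y+[ax+c] a c x y = begin
    a * x + 1# * y + c ≡⟨ cong (λ t → a * x + t + c) (*-identityˡ y) ⟩
    a * x + y + c      ≡⟨ cong (_+ c) (+-comm (a * x) y) ⟩
    y + a * x + c      ≡⟨ +-assoc y (a * x) c ⟩
    y + (a * x + c)    ∎
    where open ≡-Reasoning

  validTriple-1 : ∀ a c → ValidTriple (a , 1# , c)
  validTriple-1 a c (_ , 1-nonunit , _) = 1-nonunit (1# , *-identityˡ 1#)

  sameLine⇒slope≡ : ∀ {a a' c c'} → SameLine (a , 1# , c) (a' , 1# , c') → a ≡ a'
  sameLine⇒slope≡ {a} {a'} {c} {c'} same = ∙-cancelʳ c a a' (begin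
    a + c           ≡⟨ cong (_+ c) (*-identityʳ a) ⟨
    a * 1# + c      ≡⟨ affine≡ 1# ⟨
    a' * 1# + c'    ≡⟨ cong₂ _+_ (*-identityʳ a') c'≡c ⟩
    a' + c          ∎)
    where
    open ≡-Reasoning
    affine≡ : ∀ x → a' * x + c' ≡ a * x + c
    affine≡ x = trans (inverseʳ-unique y (a' * x + c') on′) (⁻¹-involutive (a * x + c))
      where
      y : Carrier
      y = - (a * x + c)
      on : OnLine (a , 1# , c) (x , y)
      on = trans (ax+1y+c≡y+[ax+c] a c x y) (-‿inverseˡ (a * x + c))
      on′ : y + (a' * x + c') ≡ 0#
      on′ = trans (sym (ax+1y+c≡y+[ax+c] a' c' x y)) (proj₁ (same (x , y)) on)
    c'≡c : c' ≡ c
    c'≡c = begin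
      c'           ≡⟨ +-identityˡ c' ⟨
      0# + c'      ≡⟨ cong (_+ c') (zeroʳ a') ⟨
      a' * 0# + c' ≡⟨ affine≡ 0# ⟩
      a * 0# + c   ≡⟨ cong (_+ c) (zeroʳ a) ⟩
      0# + c       ≡⟨ +-identityˡ c ⟩
      c            ∎

-- imported only here so that ℕ's _+_ and _*_ do not clash with the ring operations above
open import Data.Nat
  using (ℕ; zero; suc; _^_; _≤_; _<_; _*_; _∸_; _+_; _≤?_; _<?_; z≤n; NonZero; >-nonZero⁻¹)
import Data.Nat.Properties as ℕ
open import Data.Nat.Tactic.RingSolver using (solve-∀)
open import Algebra.Properties.Semiring.Sum ℕ.+-*-semiring
  using (sum; sum-syntax; sum-cong-≗; ∑-comm; ∑-distrib-+; *-distribˡ-sum; *-distribʳ-sum)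

indicator : ∀ {p} {P : Set p} → Dec P → ℕ
indicator P? = if does P? then 1 else 0

sum-const : ∀ n x → ∑[ i < n ] x ≡ n * x
sum-const zero    x = refl
sum-const (suc n) x = cong (x +_) (sum-const n x)

sum-mono-≤ : ∀ {n} {f g : Fin n → ℕ} → (∀ i → f i ≤ g i) → sum f ≤ sum g
sum-mono-≤ {zero}  f≤g = z≤n
sum-mono-≤ {suc n} f≤g = ℕ.+-mono-≤ (f≤g fzero) (sum-mono-≤ (f≤g ∘ fsuc))

sum-δ : ∀ {n} (k : Fin n) (g : Fin n → ℕ) → ∑[ i < n ] (indicator (k ≟ i) * g i) ≡ g k
sum-δ {suc n} fzero g = begin
  1 * g fzero + ∑[ i < n ] 0 ≡⟨ cong₂ _+_ (ℕ.*-identityˡ (g fzero)) (sum-const n 0) ⟩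
  g fzero + n * 0            ≡⟨ cong (g fzero +_) (ℕ.*-zeroʳ n) ⟩
  g fzero + 0                ≡⟨ ℕ.+-identityʳ (g fzero) ⟩
  g fzero                    ∎
  where open ≡-Reasoning
sum-δ {suc n} (fsuc k) g = sum-δ {n} k (g ∘ fsuc)

count : ∀ {n p} {P : Pred (Fin n) p} → Decidable P → ℕ
count {n} P? = ∑[ i < n ] indicator (P? i)

enumerate : ∀ {n p} {P : Pred (Fin n) p} (P? : Decidable P) →
  Σ (Fin (count P?) → Fin n) λ f → Injective _≡_ _≡_ f × (∀ t → P (f t))
enumerate {zero}  P? = (λ ()) , (λ {}) , (λ ())
enumerate {suc n} {P = P} P? with P? fzero | enumerate (P? ∘ fsuc)
... | no _   | f , f-inj , Pf = fsuc ∘ f , f-inj ∘ suc-injective , Pf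
... | yes P0 | f , f-inj , Pf = g , g-inj , Pg
  where
  g : Fin (suc (count (P? ∘ fsuc))) → Fin (suc n)
  g fzero    = fzero
  g (fsuc t) = fsuc (f t)
  g-inj : Injective _≡_ _≡_ g
  g-inj {fzero}  {fzero}  _  = refl
  g-inj {fsuc s} {fsuc t} eq = cong fsuc (f-inj (suc-injective eq))
  Pg : ∀ t → P (g t)
  Pg fzero    = P0
  Pg (fsuc t) = Pf t

subfamily : ∀ {m n p} {P : Pred (Fin n) p} (P? : Decidable P) → m ≤ count P? →
  Σ (Fin m → Fin n) λ f → Injective _≡_ _≡_ f × (∀ t → P (f t))
subfamily P? m≤count with enumerate P?
... | f , f-inj , Pf =
  f ∘ (λ t → inject≤ t m≤count) ,
  (λ eq → inject≤-injective m≤count m≤count _ _ (f-inj eq)) ,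
  (λ t → Pf (inject≤ t m≤count))

fiber-size : ∀ {m n} → (Fin m → Fin n) → Fin n → ℕ
fiber-size h c = count (λ i → h i ≟ c)

sum-over-fibers : ∀ {m n} (h : Fin m → Fin n) (g : Fin n → ℕ) →
  ∑[ i < m ] g (h i) ≡ ∑[ c < n ] (fiber-size h c * g c)
sum-over-fibers {m} {n} h g = begin
  ∑[ i < m ] g (h i)
    ≡⟨ sum-cong-≗ (λ i → sym (sum-δ (h i) g)) ⟩
  ∑[ i < m ] ∑[ c < n ] (δ i c * g c)
    ≡⟨ ∑-comm (λ i c → δ i c * g c) ⟩
  ∑[ c < n ] ∑[ i < m ] (δ i c * g c)
    ≡⟨ sum-cong-≗ (λ c → sym (*-distribʳ-sum (g c) (λ i → δ i c))) ⟩
  ∑[ c < n ] (fiber-size h c * g c) ∎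
  where
  open ≡-Reasoning
  δ : Fin m → Fin n → ℕ
  δ i c = indicator (h i ≟ c)

sum-fiber-sizes : ∀ {m n} (h : Fin m → Fin n) → ∑[ c < n ] fiber-size h c ≡ m
sum-fiber-sizes {m} {n} h = begin
  ∑[ c < n ] fiber-size h c      ≡⟨ sum-cong-≗ (λ c → sym (ℕ.*-identityʳ (fiber-size h c))) ⟩
  ∑[ c < n ] (fiber-size h c * 1) ≡⟨ sum-over-fibers h (λ _ → 1) ⟨
  ∑[ i < m ] 1                   ≡⟨ sum-const m 1 ⟩
  m * 1                          ≡⟨ ℕ.*-identityʳ m ⟩
  m                              ∎
  where open ≡-Reasoning

n≤n*[M<n]+M : ∀ {M} n (M<n? : Dec (M < n)) → n ≤ n * indicator M<n? + M
n≤n*[M<n]+M {M} n (yes _)    = ℕ.≤-trans (ℕ.≤-reflexive (sym (ℕ.*-identityʳ n))) (ℕ.m≤m+n (n * 1) M)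
n≤n*[M<n]+M {M} n (no  M≮n) = ℕ.≤-trans (ℕ.≮⇒≥ M≮n) (ℕ.m≤n+m M (n * 0))

points-on-large-fibers : ∀ {m n} M (h : Fin m → Fin n) →
  m ≤ count (λ i → M <? fiber-size h (h i)) + n * M
points-on-large-fibers {m} {n} M h = begin
  m
    ≡⟨ sum-fiber-sizes h ⟨
  ∑[ c < n ] fiber-size h c
    ≤⟨ sum-mono-≤ (λ c → n≤n*[M<n]+M (fiber-size h c) (large? c)) ⟩
  ∑[ c < n ] (fiber-size h c * indicator (large? c) + M)
    ≡⟨ ∑-distrib-+ (λ c → fiber-size h c * indicator (large? c)) (λ _ → M) ⟩
  ∑[ c < n ] (fiber-size h c * indicator (large? c)) + ∑[ c < n ] M
    ≡⟨ cong₂ _+_ (sum-over-fibers h (indicator ∘ large?)) (sym (sum-const n M)) ⟨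
  count (λ i → large? (h i)) + n * M ∎
  where
  open ℕ.≤-Reasoning
  large? : ∀ c → Dec (M < fiber-size h c)
  large? c = M <? fiber-size h c

incidences-on-large-fibers : ∀ {k m n} M (h : Fin k → Fin m → Fin n) →
  k * m ≤ ∑[ i < m ] count (λ a → M <? fiber-size (h a) (h a i)) + k * (n * M)
incidences-on-large-fibers {k} {m} {n} M h = begin
  k * m
    ≡⟨ sum-const k m ⟨
  ∑[ a < k ] m
    ≤⟨ sum-mono-≤ (λ a → points-on-large-fibers M (h a)) ⟩
  ∑[ a < k ] (∑[ i < m ] incidence a i + n * M)
    ≡⟨ ∑-distrib-+ (λ a → ∑[ i < m ] incidence a i) (λ _ → n * M) ⟩
  ∑[ a < k ] ∑[ i < m ] incidence a i + ∑[ a < k ] (n * M)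
    ≡⟨ cong₂ _+_ (∑-comm incidence) (sum-const k (n * M)) ⟩
  ∑[ i < m ] ∑[ a < k ] incidence a i + k * (n * M) ∎
  where
  open ℕ.≤-Reasoning
  incidence : Fin k → Fin m → ℕ
  incidence a i = indicator (M <? fiber-size (h a) (h a i))

∃-≥-average : ∀ {n} (f : Fin n → ℕ) b → 0 < n → n * b ≤ sum f → ∃ λ i → b ≤ f i
∃-≥-average {suc n} f b _ nb≤sum with any? (λ i → b ≤? f i)
... | yes found = found
... | no  none  = contradiction (ℕ.+-cancelʳ-≤ (sum f) (suc (∑[ i < n ] 1)) 0 n+sum≤sum) λ ()
  where
  open ℕ.≤-Reasoning
  n+sum≤sum : ∑[ i < suc n ] 1 + sum f ≤ sum f
  n+sum≤sum = begin
    ∑[ i < suc n ] 1 + sum f       ≡⟨ ∑-distrib-+ (λ _ → 1) f ⟨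
    ∑[ i < suc n ] suc (f i)       ≤⟨ sum-mono-≤ (λ i → ℕ.≰⇒> (λ b≤fi → none (i , b≤fi))) ⟩
    ∑[ i < suc n ] b               ≡⟨ sum-const (suc n) b ⟩
    suc n * b                      ≤⟨ nb≤sum ⟩
    sum f                          ∎

N*S≤T+N*[N*M]⇒S*N≤8*T : ∀ {M N S T} → S ≡ 8 * (M * N) → N * S ≤ T + N * (N * M) → S * N ≤ 8 * T
N*S≤T+N*[N*M]⇒S*N≤8*T {M} {N} {T = T} refl hyp = begin
  8 * (M * N) * N ≡⟨ S*N≡8X M N ⟩
  8 * X           ≤⟨ ℕ.*-monoʳ-≤ 8 X≤T ⟩
  8 * T           ∎
  where
  open ℕ.≤-Reasoning
  X : ℕ
  X = N * (N * M)
  S*N≡8X : ∀ M N → 8 * (M * N) * N ≡ 8 * (N * (N * M))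
  S*N≡8X = solve-∀
  7X+X≡N*S : ∀ M N → 7 * (N * (N * M)) + N * (N * M) ≡ N * (8 * (M * N))
  7X+X≡N*S = solve-∀
  X≤T : X ≤ T
  X≤T = ℕ.≤-trans (ℕ.m≤n*m X 7)
                  (ℕ.+-cancelʳ-≤ X (7 * X) T (ℕ.≤-trans (ℕ.≤-reflexive (7X+X≡N*S M N)) hyp))

^[2r∸1]≡^[r∸1]*^r : ∀ q r → q ^ (2 * r ∸ 1) ≡ q ^ (r ∸ 1) * q ^ r
^[2r∸1]≡^[r∸1]*^r q zero    = refl
^[2r∸1]≡^[r∸1]*^r q (suc r) = trans (cong (q ^_) (cong (r +_) (cong suc (ℕ.+-identityʳ r))))
                                    (ℕ.^-distribˡ-+-* q r (suc r))

module _ {q r : ℕ} (ℛ : FiniteValuationRing q r)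
         (E : Fin (8 * q ^ (2 * r ∸ 1)) → FiniteValuationRing.Point ℛ) where
  open FiniteValuationRing ℛ
    using (Carrier; Triple; ValidTriple; SameLine; OnLine; 0#; 1#; ring; order; residue)
  open Lines ring

  index : Carrier → Fin (q ^ r)
  index = Inverse.to order

  slope : Fin (q ^ r) → Carrier
  slope = Inverse.from order

  index-injective : Injective _≡_ _≡_ index
  index-injective = Injection.injective (↔⇒↣ order)

  slope-injective : Injective _≡_ _≡_ slope
  slope-injective = Injection.injective (↔⇒↣ (↔-sym order))

  -- the lines of a fixed slope partition the plane; `pencil a` sends a point to (the index of)
  -- the intercept of its line of slope `slope a`
  pencil : Fin (q ^ r) → Fin (8 * q ^ (2 * r ∸ 1)) → Fin (q ^ r)
  pencil a i = index (intercept (slope a) (E i))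

  rich? : ∀ z a → Dec (q ^ (r ∸ 1) < fiber-size (pencil a) (pencil a z))
  rich? z a = q ^ (r ∸ 1) <? fiber-size (pencil a) (pencil a z)

  rich-line-count : Fin (8 * q ^ (2 * r ∸ 1)) → ℕ
  rich-line-count z = count (rich? z)

  RichLinesThrough : Fin (8 * q ^ (2 * r ∸ 1)) → ℕ → Set
  RichLinesThrough z k =
    Σ (Fin k → Triple) λ L →
      (∀ j → ValidTriple (L j)) ×
      (∀ j j' → SameLine (L j) (L j') → j ≡ j') ×
      (∀ j → OnLine (L j) (E z)) ×
      (∀ j → Σ (Fin (q ^ (r ∸ 1) + 1) → Fin (8 * q ^ (2 * r ∸ 1))) λ g →
               Injective _≡_ _≡_ g × (∀ t → OnLine (L j) (E (g t))))

  rich-lines-through : ∀ z → RichLinesThrough z (rich-line-count z)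
  rich-lines-through z with enumerate (rich? z)
  ... | a , a-inj , a-rich =
    L , (λ j → validTriple-1 _ _) , distinct , (λ j → onLine-intercept _ (E z)) , points
    where
    L : Fin (rich-line-count z) → Triple
    L j = slope (a j) , 1# , intercept (slope (a j)) (E z)
    distinct : ∀ j j' → SameLine (L j) (L j') → j ≡ j'
    distinct j j' same = a-inj (slope-injective (sameLine⇒slope≡ same))
    points : ∀ j → Σ (Fin (q ^ (r ∸ 1) + 1) → Fin (8 * q ^ (2 * r ∸ 1))) λ g →
               Injective _≡_ _≡_ g × (∀ t → OnLine (L j) (E (g t)))
    points j with subfamily (λ i → pencil (a j) i ≟ pencil (a j) z)
                            (ℕ.≤-trans (ℕ.≤-reflexive (ℕ.+-comm (q ^ (r ∸ 1)) 1)) (a-rich j))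
    ... | g , g-inj , same-intercept = g , g-inj , λ t →
      subst (λ c → OnLine (slope (a j) , 1# , c) (E (g t)))
            (index-injective (same-intercept t)) (onLine-intercept (slope (a j)) (E (g t)))

  point-on-many-rich-lines : ∃ λ z → q ^ r ≤ 8 * rich-line-count z
  point-on-many-rich-lines =
    ∃-≥-average (λ z → 8 * rich-line-count z) (q ^ r) (>-nonZero⁻¹ _ {{8*q^k≢0}})
      (subst (8 * q ^ (2 * r ∸ 1) * q ^ r ≤_) (*-distribˡ-sum 8 rich-line-count)
        (N*S≤T+N*[N*M]⇒S*N≤8*T (cong (8 *_) (^[2r∸1]≡^[r∸1]*^r q r))
                                (incidences-on-large-fibers (q ^ (r ∸ 1)) pencil)))
    where
    -- the residue field is nonempty
    q≢0 : NonZero q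
    q≢0 = nonZeroIndex (proj₁ (proj₂ (proj₂ residue) 0#))
    8*q^k≢0 : NonZero (8 * q ^ (2 * r ∸ 1))
    8*q^k≢0 = ℕ.m*n≢0 8 (q ^ (2 * r ∸ 1)) {{_}} {{ℕ.m^n≢0 q (2 * r ∸ 1) {{q≢0}}}}

open FiniteValuationRing using (Point; Triple; ValidTriple; SameLine; OnLine)

lemma4p1 : (q r : ℕ) (R : FiniteValuationRing q r) →
    (E : Fin (8 * q ^ (2 * r ∸ 1)) → Point R) → Injective _≡_ _≡_ E →
    ∃ λ z → ∃ λ k → (q ^ r ≤ 8 * k) ×
      Σ (Fin k → Triple R) λ L →
        (∀ j → ValidTriple R (L j)) ×
        (∀ j j' → SameLine R (L j) (L j') → j ≡ j') ×
        (∀ j → OnLine R (L j) (E z)) ×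
        (∀ j → Σ (Fin (q ^ (r ∸ 1) + 1) → Fin (8 * q ^ (2 * r ∸ 1))) λ g →
                 Injective _≡_ _≡_ g × (∀ t → OnLine R (L j) (E (g t))))
lemma4p1 q r R E _ with point-on-many-rich-lines R E
... | z , many = z , rich-line-count R E z , many , rich-lines-through R E z
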